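{- Let $n\ge4$ be an integer with $n\equiv r\pmod 6$, $r\in\{4,5\}$, let $\mathrm{TH}_m=\binom{m+2}{3}$, and let $\mathcal{TH}_n=\langle \mathrm{TH}_n,\mathrm{TH}_{n+1},\mathrm{TH}_{n+2},\mathrm{TH}_{n+3}\rangle$ with minimal system of generators arranged as $(n_1,n_2,n_3,n_4)=(\mathrm{TH}_{n+3},\mathrm{TH}_{n+2},\mathrm{TH}_{n+1},\mathrm{TH}_n)$. Then, with $k$ a non-negative integer: (1) $c^*_2=\frac{n+5}{3}$, $c^*_3=\frac{n+4}{2}$, $c^*_4=n+3$ if $n=6k+4$; (2) $c^*_2=n+5$, $c^*_3=\frac{n+4}{3}$, $c^*_4=\frac{n+3}{2}$ if $n=6k+5$.
   Context: $\langle a_1,\ldots,a_k\rangle$ denotes the set of non-negative integer linear combinations of $a_1,\ldots,a_k$. For a numerical semigroup with minimal system of generators arranged as $(n_1,\ldots,n_e)$, and $i\in\{2,\ldots,e\}$, $c^*_i=\min\{k\in\mathbb N,\ k\ge1 \mid k n_i\in\langle n_1,\ldots,n_{i-1}\rangle\}$. For $n\ge4$, $\{\mathrm{TH}_n,\ldots,\mathrm{TH}_{n+3}\}$ is the minimal system of generators of $\mathcal{TH}_n$. -}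

module Defs where

open import Data.Nat using (ℕ; zero; suc; _+_; _*_; _≤_; _<_; _⊓_)
open import Data.Nat.Combinatorics using (_C_)
open import Data.Vec using (Vec; []; _∷_; take; lookup)
open import Data.Fin using (Fin; fromℕ<)
open import Data.Product using (Σ; _×_)
open import Relation.Binary.PropositionalEquality using (_≡_)
open import Relation.Nullary using (¬_)

TH : ℕ → ℕ
TH m = (m + 2) C 3

lincomb : ∀ {k} → Vec ℕ k → Vec ℕ k → ℕ
lincomb [] [] = 0
lincomb (c ∷ cs) (a ∷ as) = c * a + lincomb cs as

_∈⟨_⟩ : ∀ {k} → ℕ → Vec ℕ k → Set
_∈⟨_⟩ {k} x as = Σ (Vec ℕ k) (λ cs → lincomb cs as ≡ x)

prefix : ∀ {e} (i : ℕ) → Vec ℕ e → Vec ℕ (i ⊓ e)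
prefix zero xs = []
prefix (suc i) [] = []
prefix (suc i) (x ∷ xs) = x ∷ prefix i xs

-- IsCStar gens i v  (i is 1-based, 2 ≤ i ≤ e, gens = (n_1,…,n_e)):
-- v = c*_i = min { k ∈ ℕ, k ≥ 1 | k n_i ∈ ⟨n_1,…,n_{i-1}⟩ }.
-- n_i is lookup gens (i-1); ⟨n_1,…,n_{i-1}⟩ is generated by prefix (i-1) gens.
IsCStar : ∀ {e} → Vec ℕ e → (i : ℕ) → 2 ≤ i → (i ≤ e) → ℕ → Set
IsCStar {e} gens (suc i) _ i<e v =
  (1 ≤ v) × ((v * ni) ∈⟨ prefix i gens ⟩)
          × (∀ k → 1 ≤ k → k < v → ¬ ((k * ni) ∈⟨ prefix i gens ⟩))
  where ni = lookup gens (fromℕ< i<e)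

{-# OPTIONS --safe #-}
-- Since 6 TH x = x (x + 1) (x + 2), every generator is, up to the factor 6, a product of three
-- linear polynomials in k. For c*ᵢ = v we exhibit v nᵢ as a combination of the earlier generators,
-- and for minimality we split 6 nᵢ = g p with p coprime to v, such that g v divides 6 nⱼ for every
-- earlier generator nⱼ: then k nᵢ ∈ ⟨n₁, …, nᵢ₋₁⟩ forces g v ∣ g p k, hence v ∣ k.
module Submission where

open import Data.List using ([_])
open import Data.Nat using (ℕ; zero; suc; _+_; _*_; _/_; _≤_; s≤s; z≤n; NonZero; >-nonZero)
open import Data.Nat.Combinatorics using (_C_; nCk+nC[k+1]≡[n+1]C[k+1]; nC1≡n)
open import Data.Nat.Coprimality using (Coprime; coprime-divisor; Bézout-coprime)
open import Data.Nat.Divisibility using (_∣_; divides; _∣0; ∣⇒≤; *-cancelˡ-∣; ∣m∣n⇒∣m+n; ∣n⇒∣m*n)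
open import Data.Nat.DivMod using (/-congˡ; m*n/n≡m)
open import Data.Nat.GCD using (module Bézout)
open import Data.Nat.Properties
  using (+-comm; *-zeroʳ; *-identityʳ; *-distribˡ-+; *-assoc; *-comm; *-cancelˡ-≡; *-commutativeSemigroup; <⇒≱)
open import Algebra.Properties.CommutativeSemigroup *-commutativeSemigroup using (x∙yz≈y∙xz)
open import Data.Nat.Tactic.RingSolver using (solve; solve-∀)
open import Data.Product using (_×_; _,_)
open import Data.Fin using (fromℕ<)
open import Data.Vec using (Vec; []; _∷_; map; lookup)
open import Data.Vec.Properties using (map-∘; map-cong)
open import Data.Vec.Relation.Unary.All as All using (All; []; _∷_)
open import Data.Vec.Relation.Unary.All.Properties using (map⁺)
open import Relation.Binary.PropositionalEquality
  using (_≡_; refl; sym; trans; cong; cong₂; subst; subst₂; module ≡-Reasoning)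
open import Defs

open ≡-Reasoning

2*[1+x]C2≡x*[1+x] : ∀ x → 2 * ((1 + x) C 2) ≡ x * (1 + x)
2*[1+x]C2≡x*[1+x] zero = refl
2*[1+x]C2≡x*[1+x] (suc x) = begin
  2 * ((2 + x) C 2)                   ≡⟨ cong (2 *_) (nCk+nC[k+1]≡[n+1]C[k+1] (1 + x) 1) ⟨
  2 * ((1 + x) C 1 + (1 + x) C 2)     ≡⟨ *-distribˡ-+ 2 ((1 + x) C 1) _ ⟩
  2 * ((1 + x) C 1) + 2 * ((1 + x) C 2)
    ≡⟨ cong₂ (λ a b → 2 * a + b) (nC1≡n (1 + x)) (2*[1+x]C2≡x*[1+x] x) ⟩
  2 * (1 + x) + x * (1 + x)           ≡⟨ solve [ x ] ⟩
  (1 + x) * (2 + x)                   ∎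

6*[2+x]C3≡x*[1+x]*[2+x] : ∀ x → 6 * ((2 + x) C 3) ≡ x * (1 + x) * (2 + x)
6*[2+x]C3≡x*[1+x]*[2+x] zero = refl
6*[2+x]C3≡x*[1+x]*[2+x] (suc x) = begin
  6 * ((3 + x) C 3)                   ≡⟨ cong (6 *_) (nCk+nC[k+1]≡[n+1]C[k+1] (2 + x) 2) ⟨
  6 * ((2 + x) C 2 + (2 + x) C 3)     ≡⟨ *-distribˡ-+ 6 ((2 + x) C 2) _ ⟩
  6 * ((2 + x) C 2) + 6 * ((2 + x) C 3)
    ≡⟨ cong (_+ 6 * ((2 + x) C 3)) (*-assoc 3 2 ((2 + x) C 2)) ⟩
  3 * (2 * ((2 + x) C 2)) + 6 * ((2 + x) C 3)
    ≡⟨ cong₂ (λ a b → 3 * a + b) (2*[1+x]C2≡x*[1+x] (1 + x)) (6*[2+x]C3≡x*[1+x]*[2+x] x) ⟩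
  3 * ((1 + x) * (2 + x)) + x * (1 + x) * (2 + x) ≡⟨ solve [ x ] ⟩
  (1 + x) * (2 + x) * (3 + x)         ∎

6*TH≡x*[1+x]*[2+x] : ∀ x → 6 * TH x ≡ x * (1 + x) * (2 + x)
6*TH≡x*[1+x]*[2+x] x =
  trans (cong (λ y → 6 * (y C 3)) (+-comm x 2)) (6*[2+x]C3≡x*[1+x]*[2+x] x)

*-lincomb : ∀ {j} s (cs as : Vec ℕ j) → s * lincomb cs as ≡ lincomb cs (map (s *_) as)
*-lincomb s [] [] = *-zeroʳ s
*-lincomb s (c ∷ cs) (a ∷ as) = begin
  s * (c * a + lincomb cs as)              ≡⟨ *-distribˡ-+ s (c * a) _ ⟩
  s * (c * a) + s * lincomb cs as          ≡⟨ cong₂ _+_ (x∙yz≈y∙xz s c a) (*-lincomb s cs as) ⟩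
  c * (s * a) + lincomb cs (map (s *_) as) ∎

∣-lincomb : ∀ {j d} (cs as : Vec ℕ j) → All (d ∣_) as → d ∣ lincomb cs as
∣-lincomb {d = d} [] [] [] = d ∣0
∣-lincomb (c ∷ cs) (a ∷ as) (d∣a ∷ d∣as) = ∣m∣n⇒∣m+n (∣n⇒∣m*n c d∣a) (∣-lincomb cs as d∣as)

Bézout⇒coprime : ∀ {m n} x y → 1 + x * m ≡ y * n → Coprime m n
Bézout⇒coprime {m} {n} x y eq = Bézout-coprime {d = 1} (Bézout.-+ x y
  (subst₂ (λ a b → 1 + x * a ≡ y * b) (sym (*-identityʳ m)) (sym (*-identityʳ n)) eq))

∈⟨⟩⇒∣ : ∀ {j d g p b k} s (as : Vec ℕ j) .{{_ : NonZero g}} → Coprime d p → s * b ≡ g * p →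
        All (λ a → g * d ∣ s * a) as → (k * b) ∈⟨ as ⟩ → d ∣ k
∈⟨⟩⇒∣ {d = d} {g} {p} {b} {k} s as d⊥p sb≡gp gd∣s*as (cs , cs·as≡kb) =
  coprime-divisor d⊥p (*-cancelˡ-∣ g (subst (g * d ∣_) s*cs·as≡g*[p*k] gd∣s*cs·as))
  where
  gd∣s*cs·as : g * d ∣ lincomb cs (map (s *_) as)
  gd∣s*cs·as = ∣-lincomb cs (map (s *_) as) (map⁺ gd∣s*as)
  s*cs·as≡g*[p*k] : lincomb cs (map (s *_) as) ≡ g * (p * k)
  s*cs·as≡g*[p*k] = begin
    lincomb cs (map (s *_) as) ≡⟨ *-lincomb s cs as ⟨
    s * lincomb cs as          ≡⟨ cong (s *_) cs·as≡kb ⟩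
    s * (k * b)                ≡⟨ x∙yz≈y∙xz s k b ⟩
    k * (s * b)                ≡⟨ cong (k *_) sb≡gp ⟩
    k * (g * p)                ≡⟨ x∙yz≈y∙xz k g p ⟩
    g * (k * p)                ≡⟨ cong (g *_) (*-comm k p) ⟩
    g * (p * k)                ∎

-- Products x (1 + x) (2 + x) = 6 TH x are spelled out rather than named, so that the ring solver
-- can discharge instances of these hypotheses.
map-6*TH : ∀ {j} (xs : Vec ℕ j) → map (6 *_) (map TH xs) ≡ map (λ x → x * (1 + x) * (2 + x)) xs
map-6*TH xs = trans (sym (map-∘ (6 *_) TH xs)) (map-cong 6*TH≡x*[1+x]*[2+x] xs)

TH-∈⟨⟩ : ∀ {j} (cs xs : Vec ℕ j) k y →
         lincomb cs (map (λ x → x * (1 + x) * (2 + x)) xs) ≡ k * (y * (1 + y) * (2 + y)) →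
         (k * TH y) ∈⟨ map TH xs ⟩
TH-∈⟨⟩ cs xs k y eq = cs , *-cancelˡ-≡ _ _ 6 (begin
  6 * lincomb cs (map TH xs)                          ≡⟨ *-lincomb 6 cs (map TH xs) ⟩
  lincomb cs (map (6 *_) (map TH xs))                 ≡⟨ cong (lincomb cs) (map-6*TH xs) ⟩
  lincomb cs (map (λ x → x * (1 + x) * (2 + x)) xs)   ≡⟨ eq ⟩
  k * (y * (1 + y) * (2 + y))                         ≡⟨ cong (k *_) (6*TH≡x*[1+x]*[2+x] y) ⟨
  k * (6 * TH y)                                      ≡⟨ x∙yz≈y∙xz k 6 (TH y) ⟩
  6 * (k * TH y)                                      ∎)

TH-∈⟨⟩⇒∣ : ∀ {j k} (xs : Vec ℕ j) y d g p .{{_ : NonZero g}} u w → 1 + u * d ≡ w * p →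
           y * (1 + y) * (2 + y) ≡ g * p → All (λ x → g * d ∣ x * (1 + x) * (2 + x)) xs →
           (k * TH y) ∈⟨ map TH xs ⟩ → d ∣ k
TH-∈⟨⟩⇒∣ xs y d g p u w bézout y-factors gd∣xs =
  ∈⟨⟩⇒∣ 6 (map TH xs) (Bézout⇒coprime u w bézout) (trans (6*TH≡x*[1+x]*[2+x] y) y-factors)
    (map⁺ (All.map (λ {x} → subst (g * d ∣_) (sym (6*TH≡x*[1+x]*[2+x] x))) gd∣xs))

IsCStar-intro : ∀ {e} (gens : Vec ℕ e) i (2≤i : 2 ≤ suc i) (i≤e : suc i ≤ e) {v} →
  let nᵢ = lookup gens (fromℕ< i≤e) in
  1 ≤ v → (v * nᵢ) ∈⟨ prefix i gens ⟩ → (∀ {k} → (k * nᵢ) ∈⟨ prefix i gens ⟩ → v ∣ k) →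
  IsCStar gens (suc i) 2≤i i≤e v
IsCStar-intro gens i _ _ 1≤v v∈ ∈⇒v∣ =
  1≤v , v∈ , λ k 1≤k k<v k∈ → <⇒≱ k<v (∣⇒≤ {{>-nonZero 1≤k}} (∈⇒v∣ k∈))

IsCStar-cong : ∀ {e} {gs gs′ : Vec ℕ e} {v v′} i (2≤i : 2 ≤ i) (i≤e : i ≤ e) →
               gs ≡ gs′ → v ≡ v′ → IsCStar gs i 2≤i i≤e v → IsCStar gs′ i 2≤i i≤e v′
IsCStar-cong _ _ _ refl refl c = c

/-exact : ∀ m n d .{{_ : NonZero d}} → m ≡ n * d → n ≡ m / d
/-exact m n d m≡n*d = sym (trans (/-congˡ m≡n*d) (m*n/n≡m n d))

-- 3 + n rather than n + 3, so that for n = 4 + 6 * k the generators reduce to TH (7 + 6 * k), ….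
THgens : ℕ → Vec ℕ 4
THgens n = TH (3 + n) ∷ TH (2 + n) ∷ TH (1 + n) ∷ TH n ∷ []

THgens-+-comm : ∀ m n → THgens (m + n) ≡ TH (n + m + 3) ∷ TH (n + m + 2) ∷ TH (n + m + 1) ∷ TH (n + m) ∷ []
THgens-+-comm m n =
  trans (cong THgens (+-comm m n)) (cong₂ _∷_ (TH-comm 3) (cong₂ _∷_ (TH-comm 2) (cong₂ _∷_ (TH-comm 1) refl)))
  where
  TH-comm : ∀ i → TH (i + (n + m)) ≡ TH (n + m + i)
  TH-comm i = cong TH (+-comm i (n + m))

2≤2 : 2 ≤ 2
2≤2 = s≤s (s≤s z≤n)

2≤3 : 2 ≤ 3
2≤3 = s≤s (s≤s z≤n)

2≤4 : 2 ≤ 4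
2≤4 = s≤s (s≤s z≤n)

3≤4 : 3 ≤ 4
3≤4 = s≤s (s≤s (s≤s z≤n))

4≤4 : 4 ≤ 4
4≤4 = s≤s (s≤s (s≤s (s≤s z≤n)))

-- The membership witnesses, in the form of the hypothesis of TH-∈⟨⟩ (the + 0 comes from lincomb).
TH-shift : ∀ x → x * ((1 + x) * (2 + x) * (3 + x)) + 0 ≡ (3 + x) * (x * (1 + x) * (2 + x))
TH-shift = solve-∀

TH-shift-6k+6 : ∀ k → (2 + 2 * k) * ((7 + 6 * k) * (8 + 6 * k) * (9 + 6 * k)) + 0
                    ≡ (3 + 2 * k) * ((6 + 6 * k) * (7 + 6 * k) * (8 + 6 * k))
TH-shift-6k+6 = solve-∀

TH-step-6k+5 : ∀ k → (1 + k) * ((7 + 6 * k) * (8 + 6 * k) * (9 + 6 * k))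
                     + ((1 + 2 * k) * ((6 + 6 * k) * (7 + 6 * k) * (8 + 6 * k)) + 0)
                   ≡ (4 + 3 * k) * ((5 + 6 * k) * (6 + 6 * k) * (7 + 6 * k))
TH-step-6k+5 = solve-∀

c*₂[6k+4] : ∀ k → IsCStar (THgens (4 + 6 * k)) 2 2≤2 2≤4 (3 + 2 * k)
c*₂[6k+4] k = IsCStar-intro (THgens (4 + 6 * k)) 1 2≤2 2≤4 (s≤s z≤n)
  (TH-∈⟨⟩ (2 + 2 * k ∷ []) (7 + 6 * k ∷ []) (3 + 2 * k) (6 + 6 * k) (TH-shift-6k+6 k))
  (TH-∈⟨⟩⇒∣ (7 + 6 * k ∷ []) (6 + 6 * k) (3 + 2 * k) (3 * (7 + 6 * k) * (8 + 6 * k)) (2 + 2 * k)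
    (1 + 2 * k) (2 + 2 * k) (solve [ k ])
    (solve [ k ])
    (divides 1 (solve [ k ]) ∷ []))

c*₃[6k+4] : ∀ k → IsCStar (THgens (4 + 6 * k)) 3 2≤3 3≤4 (4 + 3 * k)
c*₃[6k+4] k = IsCStar-intro (THgens (4 + 6 * k)) 2 2≤3 3≤4 (s≤s z≤n)
  (TH-∈⟨⟩ (1 + k ∷ 1 + 2 * k ∷ []) (7 + 6 * k ∷ 6 + 6 * k ∷ []) (4 + 3 * k) (5 + 6 * k) (TH-step-6k+5 k))
  (TH-∈⟨⟩⇒∣ (7 + 6 * k ∷ 6 + 6 * k ∷ []) (5 + 6 * k) (4 + 3 * k) (6 * (7 + 6 * k)) ((1 + k) * (5 + 6 * k))
    (1 + 2 * k) 1 (solve [ k ])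
    (solve [ k ])
    (divides (3 + 2 * k) (solve [ k ]) ∷ divides (2 + 2 * k) (solve [ k ]) ∷ []))

c*₄[6k+4] : ∀ k → IsCStar (THgens (4 + 6 * k)) 4 2≤4 4≤4 (7 + 6 * k)
c*₄[6k+4] k = IsCStar-intro (THgens (4 + 6 * k)) 3 2≤4 4≤4 (s≤s z≤n)
  (TH-∈⟨⟩ (0 ∷ 0 ∷ 4 + 6 * k ∷ []) (7 + 6 * k ∷ 6 + 6 * k ∷ 5 + 6 * k ∷ []) (7 + 6 * k) (4 + 6 * k)
    (TH-shift (4 + 6 * k)))
  (TH-∈⟨⟩⇒∣ (7 + 6 * k ∷ 6 + 6 * k ∷ 5 + 6 * k ∷ []) (4 + 6 * k) (7 + 6 * k) 1
    ((4 + 6 * k) * (5 + 6 * k) * (6 + 6 * k))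
    (17 + 66 * k + 84 * k * k + 36 * k * k * k) (1 + k) (solve [ k ])
    (solve [ k ])
    (divides ((8 + 6 * k) * (9 + 6 * k)) (solve [ k ])
      ∷ divides ((6 + 6 * k) * (8 + 6 * k)) (solve [ k ])
      ∷ divides ((5 + 6 * k) * (6 + 6 * k)) (solve [ k ]) ∷ []))

c*₂[6k+5] : ∀ k → IsCStar (THgens (5 + 6 * k)) 2 2≤2 2≤4 (10 + 6 * k)
c*₂[6k+5] k = IsCStar-intro (THgens (5 + 6 * k)) 1 2≤2 2≤4 (s≤s z≤n)
  (TH-∈⟨⟩ (7 + 6 * k ∷ []) (8 + 6 * k ∷ []) (10 + 6 * k) (7 + 6 * k) (TH-shift (7 + 6 * k)))
  (TH-∈⟨⟩⇒∣ (8 + 6 * k ∷ []) (7 + 6 * k) (10 + 6 * k) ((8 + 6 * k) * (9 + 6 * k)) (7 + 6 * k)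
    (2 + 2 * k) (3 + 2 * k) (solve [ k ])
    (solve [ k ])
    (divides 1 (solve [ k ]) ∷ []))

c*₃[6k+5] : ∀ k → IsCStar (THgens (5 + 6 * k)) 3 2≤3 3≤4 (3 + 2 * k)
c*₃[6k+5] k = IsCStar-intro (THgens (5 + 6 * k)) 2 2≤3 3≤4 (s≤s z≤n)
  (TH-∈⟨⟩ (0 ∷ 2 + 2 * k ∷ []) (8 + 6 * k ∷ 7 + 6 * k ∷ []) (3 + 2 * k) (6 + 6 * k) (TH-shift-6k+6 k))
  (TH-∈⟨⟩⇒∣ (8 + 6 * k ∷ 7 + 6 * k ∷ []) (6 + 6 * k) (3 + 2 * k) (3 * (8 + 6 * k)) ((2 + 2 * k) * (7 + 6 * k))
    (9 + 16 * k + 6 * k * k) (2 + k) (solve [ k ])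
    (solve [ k ])
    (divides (10 + 6 * k) (solve [ k ]) ∷ divides (7 + 6 * k) (solve [ k ]) ∷ []))

c*₄[6k+5] : ∀ k → IsCStar (THgens (5 + 6 * k)) 4 2≤4 4≤4 (4 + 3 * k)
c*₄[6k+5] k = IsCStar-intro (THgens (5 + 6 * k)) 3 2≤4 4≤4 (s≤s z≤n)
  (TH-∈⟨⟩ (0 ∷ 1 + k ∷ 1 + 2 * k ∷ []) (8 + 6 * k ∷ 7 + 6 * k ∷ 6 + 6 * k ∷ []) (4 + 3 * k) (5 + 6 * k)
    (TH-step-6k+5 k))
  (TH-∈⟨⟩⇒∣ (8 + 6 * k ∷ 7 + 6 * k ∷ 6 + 6 * k ∷ []) (5 + 6 * k) (4 + 3 * k) 2
    ((5 + 6 * k) * (3 + 3 * k) * (7 + 6 * k))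
    (26 + 87 * k + 96 * k * k + 36 * k * k * k) (1 + k) (solve [ k ])
    (solve [ k ])
    (divides ((9 + 6 * k) * (10 + 6 * k)) (solve [ k ])
      ∷ divides ((7 + 6 * k) * (9 + 6 * k)) (solve [ k ])
      ∷ divides ((6 + 6 * k) * (7 + 6 * k)) (solve [ k ]) ∷ []))

lemma31 : ∀ (k : ℕ) →
    (let n = 6 * k + 4
         gens = TH (n + 3) ∷ TH (n + 2) ∷ TH (n + 1) ∷ TH n ∷ []
     in IsCStar gens 2 (s≤s (s≤s z≤n)) (s≤s (s≤s z≤n)) ((n + 5) / 3)
        × IsCStar gens 3 (s≤s (s≤s z≤n)) (s≤s (s≤s (s≤s z≤n))) ((n + 4) / 2)
        × IsCStar gens 4 (s≤s (s≤s z≤n)) (s≤s (s≤s (s≤s (s≤s z≤n)))) (n + 3))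
    × (let n = 6 * k + 5
           gens = TH (n + 3) ∷ TH (n + 2) ∷ TH (n + 1) ∷ TH n ∷ []
       in IsCStar gens 2 (s≤s (s≤s z≤n)) (s≤s (s≤s z≤n)) (n + 5)
          × IsCStar gens 3 (s≤s (s≤s z≤n)) (s≤s (s≤s (s≤s z≤n))) ((n + 4) / 3)
          × IsCStar gens 4 (s≤s (s≤s z≤n)) (s≤s (s≤s (s≤s (s≤s z≤n)))) ((n + 3) / 2))
lemma31 k =
  ( IsCStar-cong 2 2≤2 2≤4 (THgens-+-comm 4 (6 * k)) [n+5]/3 (c*₂[6k+4] k)
  , IsCStar-cong 3 2≤3 3≤4 (THgens-+-comm 4 (6 * k)) [n+4]/2 (c*₃[6k+4] k)
  , IsCStar-cong 4 2≤4 4≤4 (THgens-+-comm 4 (6 * k)) n+3 (c*₄[6k+4] k) )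
  , ( IsCStar-cong 2 2≤2 2≤4 (THgens-+-comm 5 (6 * k)) n+5 (c*₂[6k+5] k)
    , IsCStar-cong 3 2≤3 3≤4 (THgens-+-comm 5 (6 * k)) [n+4]/3 (c*₃[6k+5] k)
    , IsCStar-cong 4 2≤4 4≤4 (THgens-+-comm 5 (6 * k)) [n+3]/2 (c*₄[6k+5] k) )
  where
  [n+5]/3 : 3 + 2 * k ≡ (6 * k + 4 + 5) / 3
  [n+5]/3 = /-exact (6 * k + 4 + 5) (3 + 2 * k) 3 (solve [ k ])
  [n+4]/2 : 4 + 3 * k ≡ (6 * k + 4 + 4) / 2
  [n+4]/2 = /-exact (6 * k + 4 + 4) (4 + 3 * k) 2 (solve [ k ])
  n+3 : 7 + 6 * k ≡ 6 * k + 4 + 3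
  n+3 = solve [ k ]
  n+5 : 10 + 6 * k ≡ 6 * k + 5 + 5
  n+5 = solve [ k ]
  [n+4]/3 : 3 + 2 * k ≡ (6 * k + 5 + 4) / 3
  [n+4]/3 = /-exact (6 * k + 5 + 4) (3 + 2 * k) 3 (solve [ k ])
  [n+3]/2 : 4 + 3 * k ≡ (6 * k + 5 + 3) / 2
  [n+3]/2 = /-exact (6 * k + 5 + 3) (4 + 3 * k) 2 (solve [ k ])
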